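{- Let $\Delta^{hero}$ be the fully heterogeneous dynamic theory over dynamic theories $\Delta^{(0)},\Delta^{(1)}$ (and a set of heterogeneous atoms). If $\Delta^{(0)}$ is inductively expressive with respect to a set $\mathcal V^{(0)}_{\mathbb N}$ of integer expressive variables, then there exists (constructively) a function $u2n^{hero}:U^{(0)}\cup U^{(1)}\to\mathbb N$ such that $\Delta^{hero}$ is inductively expressive with respect to $\mathcal V^{(0)}_{\mathbb N}$. The same holds with the roles of $\Delta^{(0)}$ and $\Delta^{(1)}$ exchanged.
   Context: A dynamic theory $\Delta$ consists of: pairwise disjoint sets $\mathcal V,\mathcal A,\mathcal P$ (variables, atoms, programs); a nonempty set $U$; a nonempty set $S$ of states with $\mathrm{val}:S\times\mathcal V\to U$ satisfying interpolation (for all $\mu,\nu\in S$, $W\subseteq\mathcal V$ there is $\omega$ agreeing with $\mu$ on $W$ and with $\nu$ outside $W$); $\mathcal E_A:\mathcal A\to2^S$, $\mathrm{FV}_A$ with finite values and states agreeing on $\mathrm{FV}_A(a)$ both in or both out of $\mathcal E_A(a)$; $\mathcal E_P:\mathcal P\to2^{S\times S}$, $\mathrm{FV}_P$ with finite values, overapproximation (for $W\supseteq\mathrm{FV}_P(p)$, $\mu=_W\nu$, $(\mu,\omega)\in\mathcal E_P(p)$ there is $\tilde\omega$ with $(\nu,\tilde\omega)\in\mathcal E_P(p)$, $\omega=_W\tilde\omega$) and extensionality; $\mu=_W\nu$ means equal values on $W$. Formulas $a\mid\neg F\mid F\wedge G\mid\forall vF\mid[p]F$ with standard Kripke semantics;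 first-order = no boxes. Inductive expressivity: given $u2n:U\to\mathbb N$, $v$ is integer expressive if for every $n$ some state $\mu$ has $u2n(\mathrm{val}(\mu,v))=n$; for a set $\mathcal V_{\mathbb N}$ of such variables, $\Delta$ is inductively expressive if there are first-order-formula-valued maps $\mathrm{nat}_{>0}(v)$, $\mathrm{nat}_=(v,w)$, $\mathrm{nat}_{+1}(v,w)$ ($v,w\in\mathcal V_{\mathbb N}$) such that for all states $\mu$ and distinct $v,w$: $\mu\models\mathrm{nat}_{>0}(v)$ iff $u2n(\mathrm{val}(\mu,v))>0$; $\mu\models\mathrm{nat}_=(v,w)$ iff $u2n(\mathrm{val}(\mu,v))=u2n(\mathrm{val}(\mu,w))$; $\mu\models\mathrm{nat}_{+1}(v,w)$ iff $u2n(\mathrm{val}(\mu,v))+1=u2n(\mathrm{val}(\mu,w))$. Havoc lift: add $v:=*$ with $\mathcal E(v:=*)=\{(\mu,\nu):\mu=_{\mathcal V\setminus\{v\}}\nu\}$. Regular closure: programs $r\mid p;q\mid p\cup q\mid?(\phi)\mid p^*$ ($\phi$ first-order), standard relational semantics, $\mathcal E(?(\phi))=\{(\mu,\nu):\mu\models\phi,\mu=_{\mathcal V}\nu\}$. Simple heterogeneous theory over $\Delta^{(0)},\Delta^{(1)}$ and heterogeneous atoms $\mathcal A^c$ (evaluated on $S^{(0)}\times S^{(1)}$, satisfying atom requirements): disjoint unions of variables, atoms (plus $\mathcal A^c$) and programs; universe $U^{(0)}\cup U^{(1)}$; states $S^{(0)}\times S^{(1)}$ with $\mathrm{val}((\mu_0,\mu_1),v)=\mathrm{val}^{(i)}(\mu_i,v)$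 for $v\in\mathcal V^{(i)}$; atoms of $\mathcal A^{(0)}$ evaluate to $\mathcal E^{(0)}_A(a)\times S^{(1)}$, of $\mathcal A^{(1)}$ to $S^{(0)}\times\mathcal E^{(1)}_A(a)$; programs of $\mathcal P^{(i)}$ act via $\mathcal E^{(i)}_P$ on the $i$-th component. $\Delta^{hero}$ is the regular closure of the havoc lift of the simple heterogeneous theory. -}

module Defs where

open import Data.Nat using (ℕ; _+_; _>_)
open import Data.Product using (Σ; _×_; _,_; proj₁; proj₂)
open import Data.Sum using (_⊎_; inj₁; inj₂)
open import Data.Empty using (⊥)
open import Data.Unit using (⊤)
open import Data.List using (List; []; _∷_; _++_; map)
open import Data.List.Membership.Propositional using (_∈_)
open import Relation.Binary.PropositionalEquality using (_≡_; _≢_)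
open import Relation.Nullary using (¬_)
open import Relation.Binary.Construct.Closure.ReflexiveTransitive using (Star)
open import Function.Bundles using (_⇔_)

Agree : {S V U : Set} → (S → V → U) → (V → Set) → S → S → Set
Agree val W μ ν = ∀ v → W v → val μ v ≡ val ν v

Except : {V : Set} → V → V → Set
Except v w = w ≢ v

InList : {V : Set} → List V → V → Set
InList xs v = v ∈ xs

data FO (V A : Set) : Set where
  atom : A → FO V A
  not  : FO V A → FO V A
  and  : FO V A → FO V A → FO V A
  all  : V → FO V A → FO V A

data Fml (V A P : Set) : Set where
  atom : A → Fml V A P
  not  : Fml V A P → Fml V A P
  and  : Fml V A P → Fml V A P → Fml V A P
  all  : V → Fml V A P → Fml V A P
  box  : P → Fml V A P → Fml V A P

-- free variables of a first-order formula (over-approximation: a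
-- quantified variable is kept)
fvFO : {V A : Set} → (A → List V) → FO V A → List V
fvFO fa (atom a)  = fa a
fvFO fa (not F)   = fvFO fa F
fvFO fa (and F G) = fvFO fa F ++ fvFO fa G
fvFO fa (all v F) = v ∷ fvFO fa F

record Structure : Set₁ where
  field
    Var  : Set
    Atom : Set
    Prog : Set
    U    : Set
    S    : Set
    val  : S → Var → U
    EA   : Atom → S → Set
    FVA  : Atom → List Var
    EP   : Prog → S → S → Set
    FVP  : Prog → List Var

open Structure public

module _ (D : Structure) where
  _⊨FO_ : S D → FO (Var D) (Atom D) → Set
  μ ⊨FO atom a  = EA D a μ
  μ ⊨FO not F   = ¬ (μ ⊨FO F)
  μ ⊨FO and F G = (μ ⊨FO F) × (μ ⊨FO G)
  μ ⊨FO all v F = ∀ ν → Agree (val D) (Except v) μ ν → ν ⊨FO F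

  _⊨_ : S D → Fml (Var D) (Atom D) (Prog D) → Set
  μ ⊨ atom a  = EA D a μ
  μ ⊨ not F   = ¬ (μ ⊨ F)
  μ ⊨ and F G = (μ ⊨ F) × (μ ⊨ G)
  μ ⊨ all v F = ∀ ν → Agree (val D) (Except v) μ ν → ν ⊨ F
  μ ⊨ box p F = ∀ ν → EP D p μ ν → ν ⊨ F

record DynamicTheory : Set₁ where
  field
    str : Structure
  field
    U-nonempty : U str
    S-nonempty : S str
    interpolation : ∀ (μ ν : S str) (W : Var str → Set) → Σ (S str) λ ω →
      Agree (val str) W ω μ × Agree (val str) (λ v → ¬ W v) ω ν
    atomFV : ∀ a μ ν → Agree (val str) (InList (FVA str a)) μ ν →
      EA str a μ → EA str a ν
    overapprox : ∀ p (W : Var str → Set) → (∀ v → v ∈ FVP str p → W v) →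
      ∀ μ ν ω → Agree (val str) W μ ν → EP str p μ ω →
      Σ (S str) λ ω~ → EP str p ν ω~ × Agree (val str) W ω ω~
    extensionality : ∀ p μ μ' ω ω' →
      Agree (val str) (λ _ → ⊤) μ μ' → Agree (val str) (λ _ → ⊤) ω ω' →
      EP str p μ ω → EP str p μ' ω'

open DynamicTheory public

IntegerExpressive : (D : Structure) → (U D → ℕ) → Var D → Set
IntegerExpressive D u2n v = ∀ n → Σ (S D) λ μ → u2n (val D μ v) ≡ n

record InductivelyExpressive (D : Structure) (u2n : U D → ℕ)
                             (VN : Var D → Set) : Set where
  field
    integerExpressive : ∀ v → VN v → IntegerExpressive D u2n v
    natGt0  : (v : Var D) → VN v → FO (Var D) (Atom D)
    natEq   : (v w : Var D) → VN v → VN w → FO (Var D) (Atom D)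
    natSucc : (v w : Var D) → VN v → VN w → FO (Var D) (Atom D)
    natGt0-spec : ∀ v (hv : VN v) (μ : S D) →
      _⊨FO_ D μ (natGt0 v hv) ⇔ (u2n (val D μ v) > 0)
    natEq-spec : ∀ v w (hv : VN v) (hw : VN w) → v ≢ w → (μ : S D) →
      _⊨FO_ D μ (natEq v w hv hw) ⇔ (u2n (val D μ v) ≡ u2n (val D μ w))
    natSucc-spec : ∀ v w (hv : VN v) (hw : VN w) → v ≢ w → (μ : S D) →
      _⊨FO_ D μ (natSucc v w hv hw) ⇔ (u2n (val D μ v) + 1 ≡ u2n (val D μ w))

havocLift : Structure → Structure
havocLift D = record
  { Var = Var D ; Atom = Atom D ; Prog = Prog D ⊎ Var D
  ; U = U D ; S = S D ; val = val D ; EA = EA D ; FVA = FVA D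
  ; EP = ep ; FVP = fvp }
  where
  ep : Prog D ⊎ Var D → S D → S D → Set
  ep (inj₁ p) = EP D p
  ep (inj₂ v) μ ν = Agree (val D) (Except v) μ ν
  fvp : Prog D ⊎ Var D → List (Var D)
  fvp (inj₁ p) = FVP D p
  fvp (inj₂ v) = v ∷ []

data Reg (P F : Set) : Set where
  prim : P → Reg P F
  seq  : Reg P F → Reg P F → Reg P F
  cup  : Reg P F → Reg P F → Reg P F
  test : F → Reg P F
  star : Reg P F → Reg P F

regClosure : Structure → Structure
regClosure D = record
  { Var = Var D ; Atom = Atom D ; Prog = Reg (Prog D) (FO (Var D) (Atom D))
  ; U = U D ; S = S D ; val = val D ; EA = EA D ; FVA = FVA D
  ; EP = ep ; FVP = fvp }
  where
  ep : Reg (Prog D) (FO (Var D) (Atom D)) → S D → S D → Set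
  ep (prim p) μ ν = EP D p μ ν
  ep (seq p q) μ ν = Σ (S D) λ ω → ep p μ ω × ep q ω ν
  ep (cup p q) μ ν = ep p μ ν ⊎ ep q μ ν
  ep (test φ) μ ν = _⊨FO_ D μ φ × Agree (val D) (λ _ → ⊤) μ ν
  ep (star p) = Star (ep p)
  fvp : Reg (Prog D) (FO (Var D) (Atom D)) → List (Var D)
  fvp (prim p) = FVP D p
  fvp (seq p q) = fvp p ++ fvp q
  fvp (cup p q) = fvp p ++ fvp q
  fvp (test φ) = fvFO (FVA D) φ
  fvp (star p) = fvp p

hetVal : (D0 D1 : Structure) → S D0 × S D1 → Var D0 ⊎ Var D1 → U D0 ⊎ U D1
hetVal D0 D1 (μ0 , μ1) (inj₁ v) = inj₁ (val D0 μ0 v)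
hetVal D0 D1 (μ0 , μ1) (inj₂ v) = inj₂ (val D1 μ1 v)

record HetAtoms (D0 D1 : DynamicTheory) : Set₁ where
  field
    Ac  : Set
    EAc : Ac → S (str D0) × S (str D1) → Set
    FVc : Ac → List (Var (str D0) ⊎ Var (str D1))
    atomFVc : ∀ a (μ ν : S (str D0) × S (str D1)) →
      Agree (hetVal (str D0) (str D1)) (InList (FVc a)) μ ν →
      EAc a μ → EAc a ν
open HetAtoms public

simpleHet : (D0 D1 : DynamicTheory) → HetAtoms D0 D1 → Structure
simpleHet D0 D1 H = record
  { Var = Var T0 ⊎ Var T1
  ; Atom = (Atom T0 ⊎ Atom T1) ⊎ Ac H
  ; Prog = Prog T0 ⊎ Prog T1
  ; U = U T0 ⊎ U T1
  ; S = S T0 × S T1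
  ; val = hetVal T0 T1
  ; EA = ea ; FVA = fva ; EP = ep ; FVP = fvp }
  where
  T0 = str D0
  T1 = str D1
  ea : (Atom T0 ⊎ Atom T1) ⊎ Ac H → S T0 × S T1 → Set
  ea (inj₁ (inj₁ a)) (μ0 , μ1) = EA T0 a μ0
  ea (inj₁ (inj₂ a)) (μ0 , μ1) = EA T1 a μ1
  ea (inj₂ a) μ = EAc H a μ
  fva : (Atom T0 ⊎ Atom T1) ⊎ Ac H → List (Var T0 ⊎ Var T1)
  fva (inj₁ (inj₁ a)) = map inj₁ (FVA T0 a)
  fva (inj₁ (inj₂ a)) = map inj₂ (FVA T1 a)
  fva (inj₂ a) = FVc H a
  ep : Prog T0 ⊎ Prog T1 → S T0 × S T1 → S T0 × S T1 → Set
  ep (inj₁ p) (μ0 , μ1) (ν0 , ν1) = EP T0 p μ0 ν0 × μ1 ≡ ν1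
  ep (inj₂ p) (μ0 , μ1) (ν0 , ν1) = μ0 ≡ ν0 × EP T1 p μ1 ν1
  fvp : Prog T0 ⊎ Prog T1 → List (Var T0 ⊎ Var T1)
  fvp (inj₁ p) = map inj₁ (FVP T0 p)
  fvp (inj₂ p) = map inj₂ (FVP T1 p)

hero : (D0 D1 : DynamicTheory) → HetAtoms D0 D1 → Structure
hero D0 D1 H = regClosure (havocLift (simpleHet D0 D1 H))

liftVN₀ : {V0 V1 : Set} → (V0 → Set) → V0 ⊎ V1 → Set
liftVN₀ VN (inj₁ v) = VN v
liftVN₀ VN (inj₂ v) = ⊥

liftVN₁ : {V0 V1 : Set} → (V1 → Set) → V0 ⊎ V1 → Set
liftVN₁ VN (inj₁ v) = ⊥
liftVN₁ VN (inj₂ v) = VN v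

{-# OPTIONS --safe #-}
-- A state of Δ^hero is a pair of component states, and quantifying over a
-- variable of Δ^(i) inside Δ^hero only changes the i-th component. Hence the
-- first-order logic of Δ^(i) embeds into that of Δ^hero with truth preserved
-- (evaluated at the i-th component), and the formulas nat_{>0}, nat_=, nat_{+1}
-- of Δ^(i), translated, witness inductive expressivity of Δ^hero once u2n is
-- extended by an arbitrary value on the other universe.
module Submission where

open import Defs
open import Data.Nat using (ℕ; _+_; _>_)
open import Data.Product using (Σ; Σ-syntax; _×_; _,_; proj₁; proj₂)
open import Data.Product.Function.NonDependent.Propositional using (_×-⇔_)
open import Data.Sum using (_⊎_; inj₁; inj₂; [_,_])
open import Data.Sum.Properties using (inj₁-injective; inj₂-injective)
open import Function using (const)
open import Function.Bundles using (_⇔_; mk⇔; Equivalence)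
open import Function.Construct.Identity using (⇔-id)
open import Function.Related.Propositional using (module EquationalReasoning)
open import Function.Related.TypeIsomorphisms using (¬-cong-⇔)
open import Relation.Binary.PropositionalEquality using (_≡_; _≢_; refl; sym; trans; cong; cong₂; subst; module ≡-Reasoning)

record FOEmbedding (D E : Structure) : Set where
  field
    embedVar  : Var D → Var E
    embedAtom : Atom D → Atom E
    project   : S E → S D
    replace   : S E → S D → S E
    EA-embedAtom    : ∀ a μ → EA E (embedAtom a) μ ⇔ EA D a (project μ)
    project-replace : ∀ μ ν → project (replace μ ν) ≡ ν
    replace-agree   : ∀ v μ ν → Agree (val D) (Except v) (project μ) ν →
                      Agree (val E) (Except (embedVar v)) μ (replace μ ν)
    project-agree   : ∀ v μ ν → Agree (val E) (Except (embedVar v)) μ ν →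
                      Agree (val D) (Except v) (project μ) (project ν)

module _ {D E : Structure} (ε : FOEmbedding D E) where
  open FOEmbedding ε
  open Equivalence using (to; from)

  translate : FO (Var D) (Atom D) → FO (Var E) (Atom E)
  translate (atom a)  = atom (embedAtom a)
  translate (not F)   = not (translate F)
  translate (and F G) = and (translate F) (translate G)
  translate (all v F) = all (embedVar v) (translate F)

  ⊨-translate : ∀ F μ → _⊨FO_ E μ (translate F) ⇔ _⊨FO_ D (project μ) F
  ⊨-translate (atom a)  μ = EA-embedAtom a μ
  ⊨-translate (not F)   μ = ¬-cong-⇔ (⊨-translate F μ)
  ⊨-translate (and F G) μ = ⊨-translate F μ ×-⇔ ⊨-translate G μ
  ⊨-translate (all v F) μ = mk⇔
    (λ h ν agr → subst (λ ν′ → _⊨FO_ D ν′ F) (project-replace μ ν)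
       (to (⊨-translate F (replace μ ν)) (h (replace μ ν) (replace-agree v μ ν agr))))
    (λ h ν agr → from (⊨-translate F ν) (h (project ν) (project-agree v μ ν agr)))

  inductivelyExpressive-transfer :
    ∀ {u2n : U D → ℕ} {u2nE : U E → ℕ} {VN : Var D → Set} {VN′ : Var E → Set} →
    S E →
    (∀ μ v → u2nE (val E μ (embedVar v)) ≡ u2n (val D (project μ) v)) →
    (∀ {w} → VN′ w → Σ[ v ∈ Var D ] VN v × embedVar v ≡ w) →
    InductivelyExpressive D u2n VN → InductivelyExpressive E u2nE VN′
  inductivelyExpressive-transfer {u2n} {u2nE} {VN} {VN′} μ₀ u2n-embedVar restrict ie = record
    { integerExpressive = integerExpressive
    ; natGt0  = λ _ hw → translate (natGt0ᴰ hw)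
    ; natEq   = λ _ _ hw hw′ → translate (natEqᴰ hw hw′)
    ; natSucc = λ _ _ hw hw′ → translate (natSuccᴰ hw hw′)
    ; natGt0-spec  = natGt0-spec
    ; natEq-spec   = natEq-spec
    ; natSucc-spec = natSucc-spec
    }
    where
    module I = InductivelyExpressive ie

    origin : ∀ {w} → VN′ w → Var D
    origin hw = proj₁ (restrict hw)

    origin∈VN : ∀ {w} (hw : VN′ w) → VN (origin hw)
    origin∈VN hw = proj₁ (proj₂ (restrict hw))

    embedVar-origin : ∀ {w} (hw : VN′ w) → embedVar (origin hw) ≡ w
    embedVar-origin hw = proj₂ (proj₂ (restrict hw))

    u2n-origin : ∀ {w} (hw : VN′ w) μ → u2n (val D (project μ) (origin hw)) ≡ u2nE (val E μ w)
    u2n-origin hw μ = trans (sym (u2n-embedVar μ (origin hw)))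
                            (cong (λ w → u2nE (val E μ w)) (embedVar-origin hw))

    natGt0ᴰ : ∀ {w} → VN′ w → FO (Var D) (Atom D)
    natGt0ᴰ hw = I.natGt0 (origin hw) (origin∈VN hw)

    natEqᴰ natSuccᴰ : ∀ {w w′} → VN′ w → VN′ w′ → FO (Var D) (Atom D)
    natEqᴰ   hw hw′ = I.natEq   (origin hw) (origin hw′) (origin∈VN hw) (origin∈VN hw′)
    natSuccᴰ hw hw′ = I.natSucc (origin hw) (origin hw′) (origin∈VN hw) (origin∈VN hw′)

    origin-distinct : ∀ {w w′} (hw : VN′ w) (hw′ : VN′ w′) → w ≢ w′ → origin hw ≢ origin hw′
    origin-distinct hw hw′ w≢w′ v≡v′ =
      w≢w′ (trans (sym (embedVar-origin hw)) (trans (cong embedVar v≡v′) (embedVar-origin hw′)))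

    integerExpressive : ∀ w → VN′ w → IntegerExpressive E u2nE w
    integerExpressive w hw n with I.integerExpressive (origin hw) (origin∈VN hw) n
    ... | ν , u2n-ν≡n = replace μ₀ ν , (begin
        u2nE (val E (replace μ₀ ν) w)                    ≡⟨ sym (u2n-origin hw (replace μ₀ ν)) ⟩
        u2n (val D (project (replace μ₀ ν)) (origin hw)) ≡⟨ cong (λ ν′ → u2n (val D ν′ (origin hw))) (project-replace μ₀ ν) ⟩
        u2n (val D ν (origin hw))                        ≡⟨ u2n-ν≡n ⟩
        n                                                ∎)
      where open ≡-Reasoning

    natGt0-spec : ∀ w (hw : VN′ w) μ →
      _⊨FO_ E μ (translate (natGt0ᴰ hw)) ⇔ (u2nE (val E μ w) > 0)
    natGt0-spec w hw μ = begin
      _ ∼⟨ ⊨-translate (natGt0ᴰ hw) μ ⟩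
      _ ∼⟨ I.natGt0-spec (origin hw) (origin∈VN hw) (project μ) ⟩
      _ ≡⟨ cong (_> 0) (u2n-origin hw μ) ⟩
      _ ∎
      where open EquationalReasoning

    natEq-spec : ∀ w w′ (hw : VN′ w) (hw′ : VN′ w′) → w ≢ w′ → ∀ μ →
      _⊨FO_ E μ (translate (natEqᴰ hw hw′))
        ⇔ (u2nE (val E μ w) ≡ u2nE (val E μ w′))
    natEq-spec w w′ hw hw′ w≢w′ μ = begin
      _ ∼⟨ ⊨-translate (natEqᴰ hw hw′) μ ⟩
      _ ∼⟨ I.natEq-spec (origin hw) (origin hw′) (origin∈VN hw) (origin∈VN hw′) (origin-distinct hw hw′ w≢w′) (project μ) ⟩
      _ ≡⟨ cong₂ _≡_ (u2n-origin hw μ) (u2n-origin hw′ μ) ⟩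
      _ ∎
      where open EquationalReasoning

    natSucc-spec : ∀ w w′ (hw : VN′ w) (hw′ : VN′ w′) → w ≢ w′ → ∀ μ →
      _⊨FO_ E μ (translate (natSuccᴰ hw hw′))
        ⇔ (u2nE (val E μ w) + 1 ≡ u2nE (val E μ w′))
    natSucc-spec w w′ hw hw′ w≢w′ μ = begin
      _ ∼⟨ ⊨-translate (natSuccᴰ hw hw′) μ ⟩
      _ ∼⟨ I.natSucc-spec (origin hw) (origin hw′) (origin∈VN hw) (origin∈VN hw′) (origin-distinct hw hw′ w≢w′) (project μ) ⟩
      _ ≡⟨ cong₂ _≡_ (cong (_+ 1) (u2n-origin hw μ)) (u2n-origin hw′ μ) ⟩
      _ ∎
      where open EquationalReasoning

module _ (D0 D1 : DynamicTheory) (H : HetAtoms D0 D1) where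

  heroState : S (hero D0 D1 H)
  heroState = S-nonempty D0 , S-nonempty D1

  fstEmbedding : FOEmbedding (str D0) (hero D0 D1 H)
  fstEmbedding = record
    { embedVar  = inj₁
    ; embedAtom = λ a → inj₁ (inj₁ a)
    ; project   = proj₁
    ; replace   = λ (_ , μ₁) ν₀ → ν₀ , μ₁
    ; EA-embedAtom    = λ _ _ → ⇔-id _
    ; project-replace = λ _ _ → refl
    ; replace-agree   = replace-agree
    ; project-agree   = λ _ _ _ agr w w≢v → inj₁-injective (agr (inj₁ w) (λ { refl → w≢v refl }))
    }
    where
    replace-agree : ∀ v μ ν₀ → Agree (val (str D0)) (Except v) (proj₁ μ) ν₀ →
                    Agree (val (hero D0 D1 H)) (Except (inj₁ v)) μ (ν₀ , proj₂ μ)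
    replace-agree _ _ _ agr (inj₁ w) w≢v = cong inj₁ (agr w (λ w≡v → w≢v (cong inj₁ w≡v)))
    replace-agree _ _ _ _   (inj₂ w) _   = refl

  sndEmbedding : FOEmbedding (str D1) (hero D0 D1 H)
  sndEmbedding = record
    { embedVar  = inj₂
    ; embedAtom = λ a → inj₁ (inj₂ a)
    ; project   = proj₂
    ; replace   = λ (μ₀ , _) ν₁ → μ₀ , ν₁
    ; EA-embedAtom    = λ _ _ → ⇔-id _
    ; project-replace = λ _ _ → refl
    ; replace-agree   = replace-agree
    ; project-agree   = λ _ _ _ agr w w≢v → inj₂-injective (agr (inj₂ w) (λ { refl → w≢v refl }))
    }
    where
    replace-agree : ∀ v μ ν₁ → Agree (val (str D1)) (Except v) (proj₂ μ) ν₁ →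
                    Agree (val (hero D0 D1 H)) (Except (inj₂ v)) μ (proj₁ μ , ν₁)
    replace-agree _ _ _ _   (inj₁ w) _   = refl
    replace-agree _ _ _ agr (inj₂ w) w≢v = cong inj₂ (agr w (λ w≡v → w≢v (cong inj₂ w≡v)))

liftVN₀-origin : ∀ {V0 V1 : Set} {VN : V0 → Set} {w : V0 ⊎ V1} →
                 liftVN₀ VN w → Σ[ v ∈ V0 ] VN v × inj₁ v ≡ w
liftVN₀-origin {w = inj₁ v} hv = v , hv , refl

liftVN₁-origin : ∀ {V0 V1 : Set} {VN : V1 → Set} {w : V0 ⊎ V1} →
                 liftVN₁ VN w → Σ[ v ∈ V1 ] VN v × inj₂ v ≡ w
liftVN₁-origin {w = inj₂ v} hv = v , hv , refl

mainTheorem15 : (D0 D1 : DynamicTheory) (H : HetAtoms D0 D1) →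
      ((VN : Var (str D0) → Set) (u2n : U (str D0) → ℕ) →
        InductivelyExpressive (str D0) u2n VN →
        Σ (U (str D0) ⊎ U (str D1) → ℕ) λ u2nH →
          InductivelyExpressive (hero D0 D1 H) u2nH (liftVN₀ VN))
    × ((VN : Var (str D1) → Set) (u2n : U (str D1) → ℕ) →
        InductivelyExpressive (str D1) u2n VN →
        Σ (U (str D0) ⊎ U (str D1) → ℕ) λ u2nH →
          InductivelyExpressive (hero D0 D1 H) u2nH (liftVN₁ VN))
mainTheorem15 D0 D1 H =
    (λ _ u2n ie → [ u2n , const 0 ] ,
       inductivelyExpressive-transfer (fstEmbedding D0 D1 H) (heroState D0 D1 H) (λ _ _ → refl) liftVN₀-origin ie)
  , (λ _ u2n ie → [ const 0 , u2n ] ,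
       inductivelyExpressive-transfer (sndEmbedding D0 D1 H) (heroState D0 D1 H) (λ _ _ → refl) liftVN₁-origin ie)
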